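{- Let $G=(V,E)$ be a graph with $n$ vertices, let $p\colon V\to\mathbb{Z}_{>0}$, and let $m\ge 2$ be an integer. Let $\underline{\tilde y}$ denote the optimal value of the linear relaxation of the assignment formulation (AF) on the instance $(G,p,m)$. Then \[\underline{\tilde y}=\frac{1}{m}\sum_{v\in V}p(v).\]
   Context: An instance $(G,p,m)$ of Parallel Machine Scheduling with Conflicts consists of a graph $G=(V,E)$ (jobs are vertices, edges are conflicts), processing times $p$, and $m\ge 2$ identical machines; a feasible solution assigns each job to a machine so that no two adjacent jobs share a machine, and the objective is to minimize the makespan (maximum total processing time on a machine). The assignment formulation (AF) is: minimize $\tilde y$ subject to $\sum_{k=1}^m \tilde x_{vk}\ge 1$ for all $v\in V$; $\tilde x_{uk}+\tilde x_{vk}\le 1$ for all $\{u,v\}\in E$ and $k\in\{1,\dots,m\}$; $\sum_{v\in V}p(v)\tilde x_{vk}\le \tilde y$ for all $k\in\{1,\dots,m\}$; $\tilde x_{vk}\in\{0,1\}$ for all $v,k$; $\tilde y\ge 0$. Its linear relaxation replaces $\tilde x_{vk}\in\{0,1\}$ by $0\le \tilde x_{vk}\le 1$.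
   Formalization: The variables $\tilde x_{vk}$ and $\tilde y$ of the linear relaxation of (AF) take rational values. -}

module Defs where

open import Level using (0ℓ)
open import Data.Nat as ℕ using (ℕ; zero; suc)
open import Data.Fin using (Fin; zero; suc)
open import Data.Integer using (+_)
open import Data.Rational using (ℚ; _+_; _*_; _≤_; _/_; 0ℚ; 1ℚ)
open import Data.Product using (Σ; _×_; _,_)
open import Relation.Binary.PropositionalEquality using (_≡_)
open import Relation.Nullary using (¬_)

record Graph (n : ℕ) : Set₁ where
  field
    Adj    : Fin n → Fin n → Set
    sym    : ∀ {u v} → Adj u v → Adj v u
    irrefl : ∀ {v} → ¬ Adj v v

sumℕ : (k : ℕ) → (Fin k → ℕ) → ℕ
sumℕ zero    f = 0
sumℕ (suc k) f = f zero ℕ.+ sumℕ k (λ i → f (suc i))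

sumℚ : (k : ℕ) → (Fin k → ℚ) → ℚ
sumℚ zero    f = 0ℚ
sumℚ (suc k) f = f zero + sumℚ k (λ i → f (suc i))

toℚ : ℕ → ℚ
toℚ a = + a / 1

record AFRelaxFeasible {n : ℕ} (G : Graph n) (p : Fin n → ℕ) (m : ℕ)
                       (x : Fin n → Fin m → ℚ) (y : ℚ) : Set where
  open Graph G
  field
    x-lower  : ∀ v k → 0ℚ ≤ x v k
    x-upper  : ∀ v k → x v k ≤ 1ℚ
    cover    : ∀ v → 1ℚ ≤ sumℚ m (λ k → x v k)
    conflict : ∀ u v → Adj u v → ∀ k → x u k + x v k ≤ 1ℚ
    load     : ∀ k → sumℚ n (λ v → toℚ (p v) * x v k) ≤ y
    y-nonneg : 0ℚ ≤ y

IsLPRelaxOptimalValue : {n : ℕ} (G : Graph n) (p : Fin n → ℕ) (m : ℕ) → ℚ → Set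
IsLPRelaxOptimalValue {n} G p m val =
  Σ (Fin n → Fin m → ℚ) (λ x → AFRelaxFeasible G p m x val)
  × (∀ (x : Fin n → Fin m → ℚ) (y : ℚ) → AFRelaxFeasible G p m x y → val ≤ y)

-- Spreading every job evenly, x v k = 1/m, is feasible: each conflict edge
-- loads a machine by 2/m ≤ 1, and every machine carries exactly (Σ p)/m.
-- Conversely, summing the load constraints over the m machines and using
-- the cover constraints gives Σ p ≤ Σ_k Σ_v p(v) x v k ≤ m y for any
-- feasible (x, y).
module Submission where

open import Defs
open import Data.Nat using (ℕ; _≤_; _<_; NonZero)
open import Data.Fin using (Fin)
open import Data.Integer using (+_)
open import Data.Rational using (_/_)

open import Data.Nat as ℕ using (zero; suc; _∸_)
import Data.Nat.Properties as ℕₚ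
open import Data.Fin using (zero; suc)
open import Data.Integer as ℤ using (ℤ)
open import Data.Integer.Tactic.RingSolver using (solve-∀)
open import Data.Rational
  using (ℚ; _+_; _*_; 0ℚ; 1ℚ; toℚᵘ; NonNegative)
  renaming (_≤_ to _≤ℚ_)
open import Data.Rational.Properties
import Data.Rational.Unnormalised as ℚᵘ
import Data.Rational.Unnormalised.Properties as ℚᵘ
open import Data.Product using (_,_)
open import Algebra.Bundles using (CommutativeMonoid)
open import Algebra.Properties.CommutativeSemigroup
  (CommutativeMonoid.commutativeSemigroup +-0-commutativeMonoid) using (interchange)
open import Relation.Binary.PropositionalEquality

-- Identities about toℚ are checked in ℚᵘ, where + a / d is the literal pair (a, d).
toℚᵘ-/ : ∀ a d .{{_ : NonZero d}} → toℚᵘ (+ a / d) ℚᵘ.≃ ℚᵘ.mkℚᵘ (+ a) (ℕ.pred d)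
toℚᵘ-/ a (suc k) = toℚᵘ-fromℚᵘ (ℚᵘ.mkℚᵘ (+ a) k)

toℚ-+ : ∀ a b → toℚ (a ℕ.+ b) ≡ toℚ a + toℚ b
toℚ-+ a b = toℚᵘ-injective (begin
  toℚᵘ (toℚ (a ℕ.+ b))                ≈⟨ toℚᵘ-/ (a ℕ.+ b) 1 ⟩
  ℚᵘ.mkℚᵘ (+ (a ℕ.+ b)) 0              ≈⟨ ℚᵘ.*≡* (cross (+ a) (+ b)) ⟩
  ℚᵘ.mkℚᵘ (+ a) 0 ℚᵘ.+ ℚᵘ.mkℚᵘ (+ b) 0 ≈⟨ ℚᵘ.+-cong (ℚᵘ.≃-sym (toℚᵘ-/ a 1)) (ℚᵘ.≃-sym (toℚᵘ-/ b 1)) ⟩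
  toℚᵘ (toℚ a) ℚᵘ.+ toℚᵘ (toℚ b)       ≈⟨ ℚᵘ.≃-sym (toℚᵘ-homo-+ (toℚ a) (toℚ b)) ⟩
  toℚᵘ (toℚ a + toℚ b)                 ∎)
  where
  open ℚᵘ.≃-Reasoning
  cross : ∀ (x y : ℤ) → (x ℤ.+ y) ℤ.* (+ 1 ℤ.* + 1) ≡ (x ℤ.* + 1 ℤ.+ y ℤ.* + 1) ℤ.* + 1
  cross = solve-∀

/-≡-*-1/ : ∀ a d .{{_ : NonZero d}} → + a / d ≡ toℚ a * (+ 1 / d)
/-≡-*-1/ a d@(suc k) = toℚᵘ-injective (begin
  toℚᵘ (+ a / d)                        ≈⟨ toℚᵘ-/ a d ⟩
  ℚᵘ.mkℚᵘ (+ a) k                        ≈⟨ ℚᵘ.*≡* (cross (+ a) (+ d)) ⟩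
  ℚᵘ.mkℚᵘ (+ a) 0 ℚᵘ.* ℚᵘ.mkℚᵘ (+ 1) k   ≈⟨ ℚᵘ.≃-sym (ℚᵘ.*-cong (toℚᵘ-/ a 1) (toℚᵘ-/ 1 d)) ⟩
  toℚᵘ (toℚ a) ℚᵘ.* toℚᵘ (+ 1 / d)       ≈⟨ ℚᵘ.≃-sym (toℚᵘ-homo-* (toℚ a) (+ 1 / d)) ⟩
  toℚᵘ (toℚ a * (+ 1 / d))               ∎)
  where
  open ℚᵘ.≃-Reasoning
  cross : ∀ (x e : ℤ) → x ℤ.* (+ 1 ℤ.* e) ≡ (x ℤ.* + 1) ℤ.* e
  cross = solve-∀

*-1/-inverseʳ : ∀ d .{{_ : NonZero d}} → toℚ d * (+ 1 / d) ≡ 1ℚ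
*-1/-inverseʳ d@(suc k) = toℚᵘ-injective (begin
  toℚᵘ (toℚ d * (+ 1 / d))              ≈⟨ toℚᵘ-homo-* (toℚ d) (+ 1 / d) ⟩
  toℚᵘ (toℚ d) ℚᵘ.* toℚᵘ (+ 1 / d)      ≈⟨ ℚᵘ.*-cong (toℚᵘ-/ d 1) (toℚᵘ-/ 1 d) ⟩
  ℚᵘ.mkℚᵘ (+ d) 0 ℚᵘ.* ℚᵘ.mkℚᵘ (+ 1) k  ≈⟨ ℚᵘ.*≡* (cross (+ d)) ⟩
  ℚᵘ.1ℚᵘ                                ∎)
  where
  open ℚᵘ.≃-Reasoning
  cross : ∀ (x : ℤ) → (x ℤ.* + 1) ℤ.* + 1 ≡ + 1 ℤ.* (+ 1 ℤ.* x)
  cross = solve-∀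

toℚ-nonNeg : ∀ a → NonNegative (toℚ a)
toℚ-nonNeg a = normalize-nonNeg a 1

1/-nonNeg : ∀ d .{{_ : NonZero d}} → NonNegative (+ 1 / d)
1/-nonNeg d = normalize-nonNeg 1 d

toℚ-mono-≤ : ∀ {a b} → a ≤ b → toℚ a ≤ℚ toℚ b
toℚ-mono-≤ {a} {b} a≤b = begin
  toℚ a                 ≡⟨ +-identityʳ (toℚ a) ⟨
  toℚ a + 0ℚ            ≤⟨ +-monoʳ-≤ (toℚ a) (nonNegative⁻¹ (toℚ (b ∸ a)) {{toℚ-nonNeg (b ∸ a)}}) ⟩
  toℚ a + toℚ (b ∸ a)   ≡⟨ toℚ-+ a (b ∸ a) ⟨
  toℚ (a ℕ.+ (b ∸ a))   ≡⟨ cong toℚ (ℕₚ.m+[n∸m]≡n a≤b) ⟩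
  toℚ b                 ∎
  where open ≤-Reasoning

toℚ-*-1/-≤-1 : ∀ a d .{{_ : NonZero d}} → a ≤ d → toℚ a * (+ 1 / d) ≤ℚ 1ℚ
toℚ-*-1/-≤-1 a d a≤d = begin
  toℚ a * (+ 1 / d) ≤⟨ *-monoʳ-≤-nonNeg (+ 1 / d) {{1/-nonNeg d}} (toℚ-mono-≤ a≤d) ⟩
  toℚ d * (+ 1 / d) ≡⟨ *-1/-inverseʳ d ⟩
  1ℚ                ∎
  where open ≤-Reasoning

a≤d*q⇒a/d≤q : ∀ a d .{{_ : NonZero d}} {q} → toℚ a ≤ℚ toℚ d * q → + a / d ≤ℚ q
a≤d*q⇒a/d≤q a d {q} a≤dq = begin
  + a / d                   ≡⟨ /-≡-*-1/ a d ⟩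
  toℚ a * (+ 1 / d)         ≤⟨ *-monoʳ-≤-nonNeg (+ 1 / d) {{1/-nonNeg d}} a≤dq ⟩
  toℚ d * q * (+ 1 / d)     ≡⟨ cong (_* (+ 1 / d)) (*-comm (toℚ d) q) ⟩
  q * toℚ d * (+ 1 / d)     ≡⟨ *-assoc q (toℚ d) (+ 1 / d) ⟩
  q * (toℚ d * (+ 1 / d))   ≡⟨ cong (q *_) (*-1/-inverseʳ d) ⟩
  q * 1ℚ                    ≡⟨ *-identityʳ q ⟩
  q                         ∎
  where open ≤-Reasoning

sumℚ-cong : ∀ k {f g : Fin k → ℚ} → (∀ i → f i ≡ g i) → sumℚ k f ≡ sumℚ k g
sumℚ-cong zero    f≡g = refl
sumℚ-cong (suc k) f≡g = cong₂ _+_ (f≡g zero) (sumℚ-cong k (λ i → f≡g (suc i)))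

sumℚ-mono-≤ : ∀ k {f g : Fin k → ℚ} → (∀ i → f i ≤ℚ g i) → sumℚ k f ≤ℚ sumℚ k g
sumℚ-mono-≤ zero    f≤g = ≤-refl
sumℚ-mono-≤ (suc k) f≤g = +-mono-≤ (f≤g zero) (sumℚ-mono-≤ k (λ i → f≤g (suc i)))

sumℚ-const : ∀ k c → sumℚ k (λ _ → c) ≡ toℚ k * c
sumℚ-const zero    c = sym (*-zeroˡ c)
sumℚ-const (suc k) c = begin
  c + sumℚ k (λ _ → c)   ≡⟨ cong₂ _+_ (sym (*-identityˡ c)) (sumℚ-const k c) ⟩
  toℚ 1 * c + toℚ k * c  ≡⟨ *-distribʳ-+ c (toℚ 1) (toℚ k) ⟨
  (toℚ 1 + toℚ k) * c    ≡⟨ cong (_* c) (toℚ-+ 1 k) ⟨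
  toℚ (suc k) * c        ∎
  where open ≡-Reasoning

sumℚ-*-distribˡ : ∀ k c (f : Fin k → ℚ) → c * sumℚ k f ≡ sumℚ k (λ i → c * f i)
sumℚ-*-distribˡ zero    c f = *-zeroʳ c
sumℚ-*-distribˡ (suc k) c f =
  trans (*-distribˡ-+ c (f zero) (sumℚ k (λ i → f (suc i))))
        (cong (_+_ (c * f zero)) (sumℚ-*-distribˡ k c (λ i → f (suc i))))

sumℚ-+ : ∀ k (f g : Fin k → ℚ) → sumℚ k (λ i → f i + g i) ≡ sumℚ k f + sumℚ k g
sumℚ-+ zero    f g = refl
sumℚ-+ (suc k) f g =
  trans (cong (_+_ (f zero + g zero)) (sumℚ-+ k (λ i → f (suc i)) (λ i → g (suc i))))
        (interchange (f zero) (g zero) (sumℚ k (λ i → f (suc i))) (sumℚ k (λ i → g (suc i))))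

sumℚ-comm : ∀ n m (f : Fin n → Fin m → ℚ) →
  sumℚ m (λ j → sumℚ n (λ v → f v j)) ≡ sumℚ n (λ v → sumℚ m (f v))
sumℚ-comm zero    m f = trans (sumℚ-const m 0ℚ) (*-zeroʳ (toℚ m))
sumℚ-comm (suc n) m f =
  trans (sumℚ-+ m (f zero) (λ j → sumℚ n (λ v → f (suc v) j)))
        (cong (_+_ (sumℚ m (f zero))) (sumℚ-comm n m (λ v → f (suc v))))

toℚ-sumℕ : ∀ n (p : Fin n → ℕ) → toℚ (sumℕ n p) ≡ sumℚ n (λ v → toℚ (p v))
toℚ-sumℕ zero    p = refl
toℚ-sumℕ (suc n) p =
  trans (toℚ-+ (p zero) (sumℕ n (λ v → p (suc v))))
        (cong (_+_ (toℚ (p zero))) (toℚ-sumℕ n (λ v → p (suc v))))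

module _ {n : ℕ} (G : Graph n) (p : Fin n → ℕ) where

  uniform-feasible : ∀ m .{{_ : NonZero m}} → 2 ≤ m →
    AFRelaxFeasible G p m (λ _ _ → + 1 / m) (+ sumℕ n p / m)
  uniform-feasible m 2≤m = record
    { x-lower  = λ _ _ → nonNegative⁻¹ u {{1/-nonNeg m}}
    ; x-upper  = λ _ _ → subst (_≤ℚ 1ℚ) (*-identityˡ u) (toℚ-*-1/-≤-1 1 m (ℕ.>-nonZero⁻¹ m))
    ; cover    = λ _ → ≤-reflexive (sym (trans (sumℚ-const m u) (*-1/-inverseʳ m)))
    ; conflict = λ _ _ _ _ → subst (_≤ℚ 1ℚ) u+u≡2*u (toℚ-*-1/-≤-1 2 m 2≤m)
    ; load     = λ _ → ≤-reflexive load≡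
    ; y-nonneg = nonNegative⁻¹ (+ sumℕ n p / m) {{normalize-nonNeg (sumℕ n p) m}}
    }
    where
    u : ℚ
    u = + 1 / m

    u+u≡2*u : toℚ 2 * u ≡ u + u
    u+u≡2*u = begin
      toℚ 2 * u           ≡⟨ cong (_* u) (toℚ-+ 1 1) ⟩
      (1ℚ + 1ℚ) * u       ≡⟨ *-distribʳ-+ u 1ℚ 1ℚ ⟩
      1ℚ * u + 1ℚ * u     ≡⟨ cong₂ _+_ (*-identityˡ u) (*-identityˡ u) ⟩
      u + u               ∎
      where open ≡-Reasoning

    load≡ : sumℚ n (λ v → toℚ (p v) * u) ≡ + sumℕ n p / m
    load≡ = begin
      sumℚ n (λ v → toℚ (p v) * u)  ≡⟨ sumℚ-cong n (λ v → *-comm (toℚ (p v)) u) ⟩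
      sumℚ n (λ v → u * toℚ (p v))  ≡⟨ sumℚ-*-distribˡ n u (λ v → toℚ (p v)) ⟨
      u * sumℚ n (λ v → toℚ (p v))  ≡⟨ cong (u *_) (toℚ-sumℕ n p) ⟨
      u * toℚ (sumℕ n p)            ≡⟨ *-comm u (toℚ (sumℕ n p)) ⟩
      toℚ (sumℕ n p) * u            ≡⟨ /-≡-*-1/ (sumℕ n p) m ⟨
      + sumℕ n p / m                ∎
      where open ≡-Reasoning

  feasible⇒sum≤m*y : ∀ m {x y} → AFRelaxFeasible G p m x y → toℚ (sumℕ n p) ≤ℚ toℚ m * y
  feasible⇒sum≤m*y m {x} {y} feasible = begin
    toℚ (sumℕ n p)                                  ≡⟨ toℚ-sumℕ n p ⟩
    sumℚ n (λ v → toℚ (p v))                        ≤⟨ sumℚ-mono-≤ n covered ⟩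
    sumℚ n (λ v → toℚ (p v) * sumℚ m (x v))         ≡⟨ sumℚ-cong n (λ v → sumℚ-*-distribˡ m (toℚ (p v)) (x v)) ⟩
    sumℚ n (λ v → sumℚ m (λ k → toℚ (p v) * x v k)) ≡⟨ sumℚ-comm n m (λ v k → toℚ (p v) * x v k) ⟨
    sumℚ m (λ k → sumℚ n (λ v → toℚ (p v) * x v k)) ≤⟨ sumℚ-mono-≤ m load ⟩
    sumℚ m (λ _ → y)                                ≡⟨ sumℚ-const m y ⟩
    toℚ m * y                                       ∎
    where
    open AFRelaxFeasible feasible
    open ≤-Reasoning

    covered : ∀ v → toℚ (p v) ≤ℚ toℚ (p v) * sumℚ m (x v)
    covered v = begin
      toℚ (p v)                  ≡⟨ *-identityʳ (toℚ (p v)) ⟨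
      toℚ (p v) * 1ℚ             ≤⟨ *-monoˡ-≤-nonNeg (toℚ (p v)) {{toℚ-nonNeg (p v)}} (cover v) ⟩
      toℚ (p v) * sumℚ m (x v)   ∎

mainTheorem1 : (n : ℕ) (G : Graph n) (p : Fin n → ℕ) (m : ℕ) .{{_ : NonZero m}}
    → (∀ v → 0 < p v) → 2 ≤ m
    → IsLPRelaxOptimalValue G p m (+ (sumℕ n p) / m)
mainTheorem1 n G p m _ 2≤m =
  (_ , uniform-feasible G p m 2≤m) ,
  λ _ _ feasible → a≤d*q⇒a/d≤q (sumℕ n p) m (feasible⇒sum≤m*y G p m feasible)
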